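{- For all integers $k\ge 3$ and $\ell\ge 2$, the limit $f(k,\ell)=\lim_{n\to\infty} f(k,\ell,n)/n$ exists and equals $\frac12$.
   Context: A tournament is an orientation of a complete graph. An arborescence is an oriented tree with a designated root such that every vertex of the tree is reachable from the root by a directed path in the tree; its depth is the length of a longest directed path in it. An edge-colored arborescence is path-monochromatic if every directed path in it is monochromatic. For a tournament $T$, $f_T(k,\ell)$ is the largest integer $m$ such that every $k$-edge coloring of $T$ contains a path-monochromatic arborescence of depth at most $\ell$ with at least $m$ vertices; $f(k,\ell,n)$ is the minimum of $f_T(k,\ell)$ over all $n$-vertex tournaments $T$. -}

module Defs where

open import Data.Nat using (ℕ; suc; _≤_; NonZero)
open import Data.Fin using (Fin)
open import Data.Fin.Subset using (Subset; _∈_; ∣_∣)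
open import Data.Bool using (Bool; true; false)
open import Data.List using (List; []; _∷_; _∷ʳ_; length)
open import Data.List.Relation.Unary.Linked using (Linked)
open import Data.Product using (Σ; ∃; _×_)
open import Data.Sum using (_⊎_)
open import Relation.Binary.PropositionalEquality using (_≡_; _≢_)

-- A tournament on vertex set Fin n: an orientation of the complete graph K_n.
-- adj u v ≡ true means the edge between u and v is oriented u → v.
record Tournament (n : ℕ) : Set where
  field
    adj     : Fin n → Fin n → Bool
    irrefl  : ∀ u → adj u u ≡ false
    total   : ∀ u v → u ≢ v → adj u v ≡ true ⊎ adj v u ≡ true
    antisym : ∀ u v → adj u v ≡ true → adj v u ≡ false
open Tournament public

-- A k-edge-colouring of T: assigns a colour in Fin k to each (ordered) pair;
-- only the values on edges u → v of T are relevant.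
Colouring : ℕ → ℕ → Set
Colouring n k = Fin n → Fin n → Fin k

record Arborescence {n : ℕ} (T : Tournament n) : Set where
  field
    verts   : Subset n
    root    : Fin n
    parent  : Fin n → Fin n
    root∈   : root ∈ verts
    parent∈ : ∀ v → v ∈ verts → v ≢ root → parent v ∈ verts
    edgeT   : ∀ v → v ∈ verts → v ≢ root → adj T (parent v) v ≡ true

  Edge : Fin n → Fin n → Set
  Edge u v = (v ∈ verts) × (v ≢ root) × (parent v ≡ u)

  DPath : List (Fin n) → Set
  DPath xs = Linked Edge xs

  field
    reach : ∀ v → v ∈ verts → v ≡ root ⊎ ∃ λ xs → DPath (root ∷ xs ∷ʳ v)

open Arborescence public

-- depth = length (number of edges) of a longest directed path: depth ≤ ℓ
DepthAtMost : ∀ {n} {T : Tournament n} → Arborescence T → ℕ → Set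
DepthAtMost A ℓ = ∀ xs → DPath A xs → length xs ≤ suc ℓ

PathMono : ∀ {n k} {T : Tournament n} → Colouring n k → Arborescence T → Set
PathMono {k = k} c A =
  ∀ xs → DPath A xs → Σ (Fin k) λ col → Linked (λ u v → c u v ≡ col) xs

HasArb : ∀ {n k} (T : Tournament n) → Colouring n k → ℕ → ℕ → Set
HasArb T c ℓ m = Σ (Arborescence T) λ A →
  PathMono c A × DepthAtMost A ℓ × (m ≤ ∣ verts A ∣)

Good : ∀ {n} (T : Tournament n) → ℕ → ℕ → ℕ → Set
Good {n} T k ℓ m = (c : Colouring n k) → HasArb T c ℓ m

IsFT : ∀ {n} (T : Tournament n) → ℕ → ℕ → ℕ → Set
IsFT T k ℓ m = Good T k ℓ m × (∀ m′ → Good T k ℓ m′ → m′ ≤ m)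

IsF : ℕ → ℕ → ℕ → ℕ → Set
IsF k ℓ n m =
  (Σ (Tournament n) λ T → IsFT T k ℓ m) ×
  (∀ (T : Tournament n) m′ → IsFT T k ℓ m′ → m ≤ m′)

-- In every tournament on n vertices some vertex r beats at least ⌈(n−1)/2⌉ others, since
-- the out-degrees sum to n(n−1)/2; the star of out-edges at r is a path-monochromatic
-- arborescence of depth 1 with 1 + ⌈(n−1)/2⌉ vertices, whatever the colouring.
-- Conversely, on 0 … n−1 let i beat j iff i < j ≤ i + d or j + d < i, where d = ⌊(n−1)/2⌋;
-- every out-degree is then at most ⌈(n−1)/2⌉.  Colour the edges inside {0 … d} and inside
-- {d+1 … n−1} with 0, lower-to-upper edges with 1 and upper-to-lower edges with 2.  Two
-- consecutive edges of equal colour stay inside one part, where the tournament is the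
-- transitive order <, so every vertex of a path-monochromatic arborescence is beaten
-- directly by its root.  Hence f(k,ℓ,n) = 1 + ⌈(n−1)/2⌉ for k ≥ 3, ℓ ≥ 1, and the ratio
-- tends to ½ at rate 1/n.

module Submission where

module Tournaments where

  open import Defs
  open import Data.Nat
    using (ℕ; zero; suc; _+_; _*_; _∸_; _≤_; _<_; _≤?_; _<?_; z≤n; s≤s; s≤s⁻¹; ⌈_/2⌉; ⌊_/2⌋)
  open import Data.Nat.Properties hiding (_≟_)
  open import Algebra.Properties.CommutativeMonoid.Sum +-0-commutativeMonoid
    using (sum; sum-syntax; sum-cong-≗; sum-replicate-zero; sum-init-last; ∑-comm; ∑-distrib-+)
  open import Data.Bool using (Bool; true; false; _∨_)
  open import Data.Bool.Properties using (∨-zeroʳ)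
  open import Data.Fin using (Fin; zero; suc; toℕ; inject₁; fromℕ)
  open import Data.Fin.Patterns using (0F; 1F; 2F)
  open import Data.Fin.Properties using (_≟_; toℕ-inject₁; toℕ-fromℕ; toℕ<n; toℕ-injective)
  open import Data.Fin.Subset using (Subset; ∣_∣; _∈_; _⊆_)
  open import Data.Fin.Subset.Properties using (p⊆q⇒∣p∣≤∣q∣)
  open import Data.Vec using (tabulate)
  open import Data.Vec.Properties using (lookup∘tabulate; []=⇒lookup; lookup⇒[]=)
  open import Data.List using ([]; _∷_; _∷ʳ_)
  open import Data.List.Relation.Unary.Linked using (Linked; []; [-]; _∷_)
  open import Data.Product using (∃; _×_; _,_; proj₁; proj₂)
  open import Data.Sum using (_⊎_; inj₁; inj₂; map; map₂)
  open import Data.Empty using (⊥-elim)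
  open import Relation.Nullary using (Dec; yes; no; does; contradiction)
  open import Relation.Nullary.Decidable using (_×-dec_; _⊎-dec_; dec-true; dec-false; toSum)
  open import Relation.Unary using (Pred) renaming (Decidable to Decidable₁)
  open import Relation.Binary using (Rel; Decidable; Irreflexive; Asymmetric; tri<; tri≈; tri>)
  open import Relation.Binary.PropositionalEquality
  open import Function using (_∘_)

  χ : Bool → ℕ
  χ true  = 1
  χ false = 0

  ∑-const : ∀ n c → ∑[ i < n ] c ≡ n * c
  ∑-const zero    c = refl
  ∑-const (suc n) c = cong (c +_) (∑-const n c)

  ∑-mono-≤ : ∀ {n} {f g : Fin n → ℕ} → (∀ i → f i ≤ g i) → sum f ≤ sum g
  ∑-mono-≤ {zero}  f≤g = z≤n
  ∑-mono-≤ {suc n} f≤g = +-mono-≤ (f≤g zero) (∑-mono-≤ (f≤g ∘ suc))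

  ∑-χ-≟ : ∀ {n} (r : Fin n) → ∑[ v < n ] χ (does (v ≟ r)) ≡ 1
  ∑-χ-≟ {suc n} zero    = cong suc (sum-replicate-zero n)
  ∑-χ-≟         (suc r) = ∑-χ-≟ r

  ∣tabulate∣ : ∀ {n} (p : Fin n → Bool) → ∣ tabulate p ∣ ≡ ∑[ i < n ] χ (p i)
  ∣tabulate∣ {zero}  p = refl
  ∣tabulate∣ {suc n} p with p zero
  ... | true  = cong suc (∣tabulate∣ (p ∘ suc))
  ... | false = ∣tabulate∣ (p ∘ suc)

  ∈-tabulate⁺ : ∀ {n} {p : Fin n → Bool} {v} → p v ≡ true → v ∈ tabulate p
  ∈-tabulate⁺ {p = p} {v} pv = lookup⇒[]= v (tabulate p) (trans (lookup∘tabulate p v) pv)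

  ∈-tabulate⁻ : ∀ {n} {p : Fin n → Bool} {v} → v ∈ tabulate p → p v ≡ true
  ∈-tabulate⁻ {p = p} {v} v∈ = trans (sym (lookup∘tabulate p v)) ([]=⇒lookup v∈)

  χ-∨-≤ : ∀ x y → χ (x ∨ y) ≤ χ x + χ y
  χ-∨-≤ true  _ = s≤s z≤n
  χ-∨-≤ false _ = ≤-refl

  count : ∀ {ℓ} {P : Pred ℕ ℓ} → Decidable₁ P → ℕ → ℕ
  count P? n = ∑[ j < n ] χ (does (P? (toℕ j)))

  module _ {ℓ} {P : Pred ℕ ℓ} (P? : Decidable₁ P) where

    count-suc : ∀ n → count P? (suc n) ≡ χ (does (P? n)) + count P? n
    count-suc n = begin
      count P? (suc n)                             ≡⟨ sum-init-last {n} (χP ∘ toℕ) ⟩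
      ∑[ j < n ] χP (toℕ (inject₁ j)) + χP (toℕ (fromℕ n))
        ≡⟨ cong₂ _+_ (sum-cong-≗ {n} (cong χP ∘ toℕ-inject₁)) (cong χP (toℕ-fromℕ n)) ⟩
      count P? n + χP n                            ≡⟨ +-comm (count P? n) (χP n) ⟩
      χP n + count P? n                            ∎
      where
      open ≡-Reasoning
      χP : ℕ → ℕ
      χP = χ ∘ does ∘ P?

    count-≤-∸ : ∀ {a} → (∀ {j} → P j → a ≤ j) → ∀ n → count P? n ≤ n ∸ a
    count-≤-∸ above zero = z≤n
    count-≤-∸ {a} above (suc n) = ≤-trans (≤-reflexive (count-suc n)) (step (P? n))
      where
      step : (Pn? : Dec (P n)) → χ (does Pn?) + count P? n ≤ suc n ∸ a
      step (yes Pn) = ≤-trans (s≤s (count-≤-∸ above n)) (≤-reflexive (sym (+-∸-assoc 1 (above Pn))))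
      step (no _)   = ≤-trans (count-≤-∸ above n) (∸-monoˡ-≤ a (n≤1+n n))

    count-≤-window : ∀ {a b} → (∀ {j} → P j → a ≤ j × j < b) → ∀ n → count P? n ≤ b ∸ a
    count-≤-window window zero = z≤n
    count-≤-window {a} {b} window (suc n) = ≤-trans (≤-reflexive (count-suc n)) (step (P? n))
      where
      step : (Pn? : Dec (P n)) → χ (does Pn?) + count P? n ≤ b ∸ a
      step (yes Pn) = begin
        suc (count P? n)  ≤⟨ s≤s (count-≤-∸ (proj₁ ∘ window) n) ⟩
        suc (n ∸ a)       ≡⟨ +-∸-assoc 1 (proj₁ (window Pn)) ⟨
        suc n ∸ a         ≤⟨ ∸-monoˡ-≤ a (proj₂ (window Pn)) ⟩
        b ∸ a             ∎
        where open ≤-Reasoning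
      step (no _) = count-≤-window window n

  count-⊎-≤ : ∀ {ℓ} {P Q : Pred ℕ ℓ} (P? : Decidable₁ P) (Q? : Decidable₁ Q) n →
    count (λ j → P? j ⊎-dec Q? j) n ≤ count P? n + count Q? n
  count-⊎-≤ P? Q? n =
    ≤-trans (∑-mono-≤ {n} (λ j → χ-∨-≤ (does (P? (toℕ j))) (does (Q? (toℕ j)))))
            (≤-reflexive (∑-distrib-+ {n} (χ ∘ does ∘ P? ∘ toℕ) (χ ∘ does ∘ Q? ∘ toℕ)))

  ⌈n/2⌉≤1+⌊n/2⌋ : ∀ n → ⌈ n /2⌉ ≤ suc ⌊ n /2⌋
  ⌈n/2⌉≤1+⌊n/2⌋ zero          = z≤n
  ⌈n/2⌉≤1+⌊n/2⌋ (suc zero)    = s≤s z≤n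
  ⌈n/2⌉≤1+⌊n/2⌋ (suc (suc n)) = s≤s (⌈n/2⌉≤1+⌊n/2⌋ n)

  outdeg : ∀ {n} → Tournament n → Fin n → ℕ
  outdeg {n} T u = ∑[ v < n ] χ (adj T u v)

  χ-pair : ∀ {n} (T : Tournament n) u v → χ (adj T u v) + χ (adj T v u) + χ (does (v ≟ u)) ≡ 1
  χ-pair T u v with v ≟ u
  ... | yes refl rewrite irrefl T v = refl
  ... | no v≢u with total T u v (v≢u ∘ sym)
  ...   | inj₁ uv rewrite uv | antisym T u v uv = refl
  ...   | inj₂ vu rewrite vu | antisym T v u vu = refl

  handshake : ∀ {n} (T : Tournament n) →
    ∑[ u < n ] outdeg T u + ∑[ u < n ] outdeg T u + n ≡ n * n
  handshake {n} T = begin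
    ∑[ u < n ] ∑[ v < n ] a u v + ∑[ u < n ] ∑[ v < n ] a u v + n
      ≡⟨ cong₂ (λ x y → ∑[ u < n ] ∑[ v < n ] a u v + x + y) (∑-comm (λ v u → a v u)) diagonal ⟩
    ∑[ u < n ] ∑[ v < n ] a u v + ∑[ u < n ] ∑[ v < n ] a v u + ∑[ u < n ] ∑[ v < n ] δ u v
      ≡⟨ cong (_+ ∑[ u < n ] ∑[ v < n ] δ u v) (∑-distrib-+ (λ u → ∑[ v < n ] a u v) _) ⟨
    ∑[ u < n ] (∑[ v < n ] a u v + ∑[ v < n ] a v u) + ∑[ u < n ] ∑[ v < n ] δ u v
      ≡⟨ ∑-distrib-+ (λ u → ∑[ v < n ] a u v + ∑[ v < n ] a v u) _ ⟨
    ∑[ u < n ] (∑[ v < n ] a u v + ∑[ v < n ] a v u + ∑[ v < n ] δ u v)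
      ≡⟨ sum-cong-≗ (λ u → sym (distrib₃ u)) ⟩
    ∑[ u < n ] ∑[ v < n ] (a u v + a v u + δ u v)
      ≡⟨ sum-cong-≗ (λ u → trans (sum-cong-≗ (χ-pair T u)) (∑-const n 1)) ⟩
    ∑[ u < n ] (n * 1)
      ≡⟨ ∑-const n (n * 1) ⟩
    n * (n * 1)
      ≡⟨ cong (n *_) (*-identityʳ n) ⟩
    n * n ∎
    where
    open ≡-Reasoning
    a δ : Fin n → Fin n → ℕ
    a u v = χ (adj T u v)
    δ u v = χ (does (v ≟ u))
    diagonal : n ≡ ∑[ u < n ] ∑[ v < n ] δ u v
    diagonal = sym (trans (sum-cong-≗ (∑-χ-≟ {n})) (trans (∑-const n 1) (*-identityʳ n)))
    distrib₃ : ∀ u → ∑[ v < n ] (a u v + a v u + δ u v) ≡ ∑[ v < n ] a u v + ∑[ v < n ] a v u + ∑[ v < n ] δ u v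
    distrib₃ u = trans (∑-distrib-+ (λ v → a u v + a v u) (δ u))
                       (cong (_+ ∑[ v < n ] δ u v) (∑-distrib-+ (a u) (λ v → a v u)))

  argmax : ∀ {n} (f : Fin (suc n) → ℕ) → ∃ λ r → ∀ u → f u ≤ f r
  argmax {zero}  f = zero , λ { zero → ≤-refl }
  argmax {suc n} f with argmax (f ∘ suc)
  ... | r , max with f zero ≤? f (suc r)
  ...   | yes f0≤ = suc r , λ { zero → f0≤ ; (suc u) → max u }
  ...   | no  f0≰ = zero  , λ { zero → ≤-refl ; (suc u) → ≤-trans (max u) (<⇒≤ (≰⇒> f0≰)) }

  ∃-outdeg-≥ : ∀ {n} (T : Tournament (suc n)) → ∃ λ r → ⌈ n /2⌉ ≤ outdeg T r
  ∃-outdeg-≥ {n} T with argmax (outdeg T)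
  ... | r , max = r , subst (⌈ n /2⌉ ≤_) (sym (n≡⌈n+n/2⌉ o)) (⌈n/2⌉-mono n≤o+o)
    where
    o = outdeg T r
    Σo = ∑[ u < suc n ] outdeg T u
    Σo≤ : Σo ≤ suc n * o
    Σo≤ = ≤-trans (∑-mono-≤ max) (≤-reflexive (∑-const (suc n) o))
    squared≤ : suc n * suc n ≤ suc n * suc (o + o)
    squared≤ = begin
      suc n * suc n                  ≡⟨ handshake T ⟨
      Σo + Σo + suc n                ≤⟨ +-monoˡ-≤ (suc n) (+-mono-≤ Σo≤ Σo≤) ⟩
      suc n * o + suc n * o + suc n  ≡⟨ cong (_+ suc n) (*-distribˡ-+ (suc n) o o) ⟨
      suc n * (o + o) + suc n        ≡⟨ +-comm (suc n * (o + o)) (suc n) ⟩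
      suc n + suc n * (o + o)        ≡⟨ *-suc (suc n) (o + o) ⟨
      suc n * suc (o + o)            ∎
      where open ≤-Reasoning
    n≤o+o : n ≤ o + o
    n≤o+o = s≤s⁻¹ (*-cancelˡ-≤ (suc n) squared≤)

  closedOutNbhd : ∀ {n} → Tournament n → Fin n → Subset n
  closedOutNbhd T r = tabulate (λ v → does (v ≟ r) ∨ adj T r v)

  module _ {n} (T : Tournament n) {r : Fin n} where

    root∈closedOutNbhd : r ∈ closedOutNbhd T r
    root∈closedOutNbhd = ∈-tabulate⁺ (cong (_∨ adj T r r) (dec-true (r ≟ r) refl))

    adj⇒∈closedOutNbhd : ∀ {v} → adj T r v ≡ true → v ∈ closedOutNbhd T r
    adj⇒∈closedOutNbhd {v} rv = ∈-tabulate⁺ (trans (cong (does (v ≟ r) ∨_) rv) (∨-zeroʳ _))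

    ∈closedOutNbhd⇒adj : ∀ {v} → v ∈ closedOutNbhd T r → v ≢ r → adj T r v ≡ true
    ∈closedOutNbhd⇒adj {v} v∈ v≢r =
      trans (cong (_∨ adj T r v) (sym (dec-false (v ≟ r) v≢r))) (∈-tabulate⁻ v∈)

    ∣closedOutNbhd∣ : ∣ closedOutNbhd T r ∣ ≡ suc (outdeg T r)
    ∣closedOutNbhd∣ = begin
      ∣ closedOutNbhd T r ∣                          ≡⟨ ∣tabulate∣ {n} _ ⟩
      ∑[ v < n ] χ (does (v ≟ r) ∨ adj T r v)       ≡⟨ sum-cong-≗ split ⟩
      ∑[ v < n ] (χ (does (v ≟ r)) + χ (adj T r v))
        ≡⟨ ∑-distrib-+ (λ v → χ (does (v ≟ r))) (χ ∘ adj T r) ⟩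
      ∑[ v < n ] χ (does (v ≟ r)) + outdeg T r       ≡⟨ cong (_+ outdeg T r) (∑-χ-≟ {n} r) ⟩
      suc (outdeg T r)                               ∎
      where
      open ≡-Reasoning
      split : ∀ v → χ (does (v ≟ r) ∨ adj T r v) ≡ χ (does (v ≟ r)) + χ (adj T r v)
      split v with v ≟ r
      ... | yes refl rewrite irrefl T v = refl
      ... | no _     = refl

  star : ∀ {n} (T : Tournament n) → Fin n → Arborescence T
  star T r = record
    { verts   = closedOutNbhd T r
    ; root    = r
    ; parent  = λ _ → r
    ; root∈   = root∈closedOutNbhd T
    ; parent∈ = λ _ _ _ → root∈closedOutNbhd T
    ; edgeT   = λ _ → ∈closedOutNbhd⇒adj T
    ; reach   = λ v v∈ → map₂ (λ v≢r → [] , (v∈ , v≢r , refl) ∷ [-]) (toSum (v ≟ r))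
    }

  module _ {n} (T : Tournament n) (r : Fin n) where

    star-pathMono : ∀ {k} (c : Colouring n (suc k)) → PathMono c (star T r)
    star-pathMono c []                  _ = zero , []
    star-pathMono c (x ∷ [])            _ = zero , [-]
    star-pathMono c (x ∷ y ∷ [])        _ = c x y , refl ∷ [-]
    star-pathMono c (x ∷ y ∷ z ∷ _) ((_ , y≢r , _) ∷ (_ , _ , r≡y) ∷ _) = ⊥-elim (y≢r (sym r≡y))

    star-depth : ∀ {ℓ} → 1 ≤ ℓ → DepthAtMost (star T r) ℓ
    star-depth _       []              _ = z≤n
    star-depth _       (x ∷ [])        _ = s≤s z≤n
    star-depth (s≤s _) (x ∷ y ∷ [])    _ = s≤s (s≤s z≤n)
    star-depth _       (x ∷ y ∷ z ∷ _) ((_ , y≢r , _) ∷ (_ , _ , r≡y) ∷ _) = ⊥-elim (y≢r (sym r≡y))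

  tournament-good : ∀ {n k ℓ} → 1 ≤ ℓ → (T : Tournament (suc n)) → Good T (suc k) ℓ (suc ⌈ n /2⌉)
  tournament-good {n} ℓ≥1 T c with ∃-outdeg-≥ T
  ... | r , bound = star T r , star-pathMono T r c , star-depth T r ℓ≥1 ,
                    subst (suc ⌈ n /2⌉ ≤_) (sym (∣closedOutNbhd∣ T)) (s≤s bound)

  MonoTransitive : ∀ {n k} → Tournament n → Colouring n k → Set
  MonoTransitive T c = ∀ u v w → adj T u v ≡ true → adj T v w ≡ true → c u v ≡ c v w →
    adj T u w ≡ true × c u w ≡ c u v

  module _ {n k} {T : Tournament n} {c : Colouring n k} (mono-trans : MonoTransitive T c)
           (A : Arborescence T) where

    edge⇒adj : ∀ {u v} → Edge A u v → adj T u v ≡ true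
    edge⇒adj {v = v} (v∈ , v≢root , refl) = edgeT A v v∈ v≢root

    monochromatic-shortcut : ∀ {col} x xs v → DPath A (x ∷ xs ∷ʳ v) →
      Linked (λ a b → c a b ≡ col) (x ∷ xs ∷ʳ v) → adj T x v ≡ true × c x v ≡ col
    monochromatic-shortcut x []       v (e ∷ [-]) (cxv ∷ [-]) = edge⇒adj e , cxv
    monochromatic-shortcut x (y ∷ ys) v (e ∷ es)  (cxy ∷ cs)
      with monochromatic-shortcut y ys v es cs
    ... | yv , cyv with mono-trans x y v (edge⇒adj e) yv (trans cxy (sym cyv))
    ...   | xv , cxv = xv , trans cxv cxy

    verts⊆closedOutNbhd : PathMono c A → verts A ⊆ closedOutNbhd T (root A)
    verts⊆closedOutNbhd pm {v} v∈ with reach A v v∈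
    ... | inj₁ refl         = root∈closedOutNbhd T
    ... | inj₂ (xs , path) with pm _ path
    ...   | _ , mono = adj⇒∈closedOutNbhd T (proj₁ (monochromatic-shortcut _ xs v path mono))

  good⇒≤ : ∀ {n k ℓ m b} {T : Tournament n} {c : Colouring n k} → MonoTransitive T c →
    (∀ u → outdeg T u ≤ b) → Good T k ℓ m → m ≤ suc b
  good⇒≤ {m = m} {b} {T} {c} mono-trans outdeg≤ good with good c
  ... | A , pm , _ , m≤ = begin
    m                            ≤⟨ m≤ ⟩
    ∣ verts A ∣                  ≤⟨ p⊆q⇒∣p∣≤∣q∣ (verts⊆closedOutNbhd mono-trans A pm) ⟩
    ∣ closedOutNbhd T (root A) ∣ ≡⟨ ∣closedOutNbhd∣ T ⟩
    suc (outdeg T (root A))      ≤⟨ s≤s (outdeg≤ (root A)) ⟩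
    suc b                        ∎
    where open ≤-Reasoning

  IsF-intro : ∀ {k ℓ n m} → (∀ T → Good T k ℓ m) →
    (T₀ : Tournament n) → (∀ m′ → Good T₀ k ℓ m′ → m′ ≤ m) → IsF k ℓ n m
  IsF-intro good T₀ max = (T₀ , good T₀ , max) , λ T m′ isFT → proj₂ isFT _ (good T)

  dec-true⁻ : ∀ {a} {A : Set a} (a? : Dec A) → does a? ≡ true → A
  dec-true⁻ (yes a) _ = a

  relationTournament : ∀ {ℓ} {R : Rel ℕ ℓ} → Decidable R → Irreflexive _≡_ R → Asymmetric R →
    (∀ {i j} → i ≢ j → R i j ⊎ R j i) → (n : ℕ) → Tournament n
  relationTournament R? irr asym tot n = record
    { adj     = λ u v → does (R? (toℕ u) (toℕ v))
    ; irrefl  = λ u → dec-false (R? _ _) (irr refl)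
    ; total   = λ u v u≢v → map (dec-true (R? _ _)) (dec-true (R? _ _)) (tot (u≢v ∘ toℕ-injective))
    ; antisym = λ u v uv → dec-false (R? _ _) (asym (dec-true⁻ (R? _ _) uv))
    }

  colourOf : ∀ {k} → Bool → Bool → Fin (3 + k)
  colourOf true  true  = 0F
  colourOf false false = 0F
  colourOf true  false = 1F
  colourOf false true  = 2F

  colourOf-chain : ∀ {k} a b c → colourOf {k} a b ≡ colourOf b c → a ≡ b × b ≡ c
  colourOf-chain true  true  true  _ = refl , refl
  colourOf-chain false false false _ = refl , refl
  colourOf-chain true  true  false ()
  colourOf-chain true  false true  ()
  colourOf-chain true  false false ()
  colourOf-chain false true  true  ()
  colourOf-chain false true  false ()
  colourOf-chain false false true  ()

  module Rotational (n : ℕ) where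

    d h : ℕ
    d = ⌊ n /2⌋
    h = ⌈ n /2⌉

    n≤1+2d : n ≤ suc (d + d)
    n≤1+2d = begin
      n           ≡⟨ ⌊n/2⌋+⌈n/2⌉≡n n ⟨
      d + h       ≤⟨ +-monoʳ-≤ d (⌈n/2⌉≤1+⌊n/2⌋ n) ⟩
      d + suc d   ≡⟨ +-suc d d ⟩
      suc (d + d) ∎
      where open ≤-Reasoning

    Forward Backward Beats : ℕ → ℕ → Set
    Forward  i j = i < j × j ≤ i + d
    Backward i j = j + d < i
    Beats    i j = Forward i j ⊎ Backward i j

    forward? : ∀ i → Decidable₁ (Forward i)
    forward? i j = (i <? j) ×-dec (j ≤? i + d)

    backward? : ∀ i → Decidable₁ (Backward i)
    backward? i j = j + d <? i

    beats? : Decidable Beats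
    beats? i j = forward? i j ⊎-dec backward? i j

    beats-irrefl : Irreflexive _≡_ Beats
    beats-irrefl refl (inj₁ (i<i , _)) = <-irrefl refl i<i
    beats-irrefl {i} refl (inj₂ i+d<i) = <⇒≱ i+d<i (m≤m+n i d)

    beats-asym : Asymmetric Beats
    beats-asym (inj₁ (i<j , _))    (inj₁ (j<i , _))    = <-asym i<j j<i
    beats-asym (inj₁ (_ , j≤i+d))  (inj₂ i+d<j)        = <⇒≱ i+d<j j≤i+d
    beats-asym (inj₂ j+d<i)        (inj₁ (_ , i≤j+d))  = <⇒≱ j+d<i i≤j+d
    beats-asym {i} {j} (inj₂ j+d<i) (inj₂ i+d<j) =
      <-asym (≤-trans (s≤s (m≤m+n j d)) j+d<i) (≤-trans (s≤s (m≤m+n i d)) i+d<j)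

    beats-total : ∀ {i j} → i ≢ j → Beats i j ⊎ Beats j i
    beats-total {i} {j} i≢j with <-cmp i j
    ... | tri≈ _ i≡j _ = contradiction i≡j i≢j
    ... | tri< i<j _ _ with j ≤? i + d
    ...   | yes j≤i+d = inj₁ (inj₁ (i<j , j≤i+d))
    ...   | no  j≰i+d = inj₂ (inj₂ (≰⇒> j≰i+d))
    beats-total {i} {j} i≢j | tri> _ _ j<i with i ≤? j + d
    ...   | yes i≤j+d = inj₂ (inj₁ (j<i , i≤j+d))
    ...   | no  i≰j+d = inj₁ (inj₂ (≰⇒> i≰j+d))

    low : ℕ → Bool
    low i = does (i ≤? d)

    SameHalf : ℕ → ℕ → Set
    SameHalf i j = (i ≤ d × j ≤ d) ⊎ (d < i × d < j)

    sameHalf : ∀ i j → low i ≡ low j → SameHalf i j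
    sameHalf i j eq with i ≤? d | j ≤? d
    ... | yes i≤d | yes j≤d = inj₁ (i≤d , j≤d)
    ... | no  i≰d | no  j≰d = inj₂ (≰⇒> i≰d , ≰⇒> j≰d)
    ... | yes i≤d | no  j≰d =
      contradiction (trans (sym (dec-true (i ≤? d) i≤d)) (trans eq (dec-false (j ≤? d) j≰d))) λ ()
    ... | no  i≰d | yes j≤d =
      contradiction (trans (sym (dec-true (j ≤? d) j≤d)) (trans (sym eq) (dec-false (i ≤? d) i≰d))) λ ()

    beats⇒< : ∀ {i j} → i ≤ n → SameHalf i j → Beats i j → i < j
    beats⇒< _ _ (inj₁ (i<j , _)) = i<j
    beats⇒< {j = j} _ (inj₁ (i≤d , _)) (inj₂ j+d<i) =
      contradiction (≤-trans i≤d (m≤n+m d j)) (<⇒≱ j+d<i)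
    beats⇒< i≤n (inj₂ (_ , d<j)) (inj₂ j+d<i) =
      contradiction (≤-trans i≤n (≤-trans n≤1+2d (+-monoˡ-≤ d d<j))) (<⇒≱ j+d<i)

    <⇒beats : ∀ {i j} → j ≤ n → SameHalf i j → i < j → Beats i j
    <⇒beats {i} _ (inj₁ (_ , j≤d)) i<j = inj₁ (i<j , ≤-trans j≤d (m≤n+m d i))
    <⇒beats j≤n (inj₂ (d<i , _)) i<j = inj₁ (i<j , ≤-trans j≤n (≤-trans n≤1+2d (+-monoˡ-≤ d d<i)))

    colour : ∀ {k} → ℕ → ℕ → Fin (3 + k)
    colour i j = colourOf (low i) (low j)

    beats-monoTransitive : ∀ {k i j l} → i ≤ n → j ≤ n → l ≤ n → Beats i j → Beats j l →
      colour {k} i j ≡ colour j l → Beats i l × colour {k} i l ≡ colour i j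
    beats-monoTransitive {i = i} {j} {l} i≤n j≤n l≤n ij jl same
      with colourOf-chain (low i) (low j) (low l) same
    ... | i~j , j~l =
      <⇒beats l≤n (sameHalf i l (trans i~j j~l))
              (<-trans (beats⇒< i≤n (sameHalf i j i~j) ij) (beats⇒< j≤n (sameHalf j l j~l) jl)) ,
      cong (colourOf (low i)) (sym j~l)

    T₀ : Tournament (suc n)
    T₀ = relationTournament beats? beats-irrefl beats-asym beats-total (suc n)

    c₀ : ∀ {k} → Colouring (suc n) (3 + k)
    c₀ u v = colour (toℕ u) (toℕ v)

    T₀-monoTransitive : ∀ {k} → MonoTransitive T₀ (c₀ {k})
    T₀-monoTransitive u v w uv vw same
      with beats-monoTransitive (≤-pred (toℕ<n u)) (≤-pred (toℕ<n v)) (≤-pred (toℕ<n w))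
                                (dec-true⁻ (beats? _ _) uv) (dec-true⁻ (beats? _ _) vw) same
    ... | uw , c-uw = dec-true (beats? _ _) uw , c-uw

    outdeg-T₀≤h : ∀ u → outdeg T₀ u ≤ h
    outdeg-T₀≤h u = ≤-trans (count-⊎-≤ (forward? i) (backward? i) (suc n)) (split (i ≤? d))
      where
      i = toℕ u
      i≤n : i ≤ n
      i≤n = ≤-pred (toℕ<n u)
      forward-window : ∀ {j} → Forward i j → suc i ≤ j × j < suc (i + d)
      forward-window (i<j , j≤i+d) = i<j , s≤s j≤i+d
      backward-window : ∀ {j} → Backward i j → 0 ≤ j × j < i ∸ d
      backward-window {j} j+d<i = z≤n , m+n≤o⇒m≤o∸n (suc j) j+d<i
      #backward≤ : count (backward? i) (suc n) ≤ i ∸ d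
      #backward≤ = count-≤-window (backward? i) backward-window (suc n)
      split : Dec (i ≤ d) → count (forward? i) (suc n) + count (backward? i) (suc n) ≤ h
      split (yes i≤d) = begin
        count (forward? i) (suc n) + count (backward? i) (suc n)
          ≤⟨ +-mono-≤ (count-≤-window (forward? i) forward-window (suc n)) #backward≤ ⟩
        suc (i + d) ∸ suc i + (i ∸ d)  ≡⟨ cong₂ _+_ (m+n∸m≡n i d) (m≤n⇒m∸n≡0 i≤d) ⟩
        d + 0                          ≡⟨ +-identityʳ d ⟩
        d                              ≤⟨ ⌊n/2⌋≤⌈n/2⌉ n ⟩
        h                              ∎
        where open ≤-Reasoning
      split (no i≰d) = begin
        count (forward? i) (suc n) + count (backward? i) (suc n)
          ≤⟨ +-mono-≤ (count-≤-∸ (forward? i) (proj₁ ∘ forward-window) (suc n)) #backward≤ ⟩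
        n ∸ i + (i ∸ d)                ≡⟨ +-∸-assoc (n ∸ i) (<⇒≤ (≰⇒> i≰d)) ⟨
        (n ∸ i + i) ∸ d                ≡⟨ cong (_∸ d) (m∸n+n≡m i≤n) ⟩
        n ∸ d                          ≡⟨ cong (_∸ d) (⌊n/2⌋+⌈n/2⌉≡n n) ⟨
        d + h ∸ d                      ≡⟨ m+n∸m≡n d h ⟩
        h                              ∎
        where open ≤-Reasoning

  IsF-1+⌈n/2⌉ : ∀ k ℓ n → 1 ≤ ℓ → IsF (3 + k) ℓ (suc n) (suc ⌈ n /2⌉)
  IsF-1+⌈n/2⌉ k ℓ n ℓ≥1 =
    IsF-intro (tournament-good ℓ≥1) T₀ (λ _ → good⇒≤ T₀-monoTransitive outdeg-T₀≤h)
    where open Rotational n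

module Approximation where

  open import Data.Nat using (ℕ; zero; suc; _+_; _*_; _∸_; _≤_; s≤s; ⌈_/2⌉)
  open import Data.Nat.Properties
  open import Data.Integer as ℤ using (+_; +[1+_]; -[1+_]; +<+)
  import Data.Integer.Properties as ℤ
  open import Data.Rational as ℚ using (ℚ; mkℚ; 0ℚ; ½; _/_; _-_; ↧ₙ_; toℚᵘ; *<*)
  import Data.Rational.Properties as ℚ
  import Data.Rational.Unnormalised as ℚᵘ
  import Data.Rational.Unnormalised.Properties as ℚᵘ
  open import Relation.Binary.PropositionalEquality
  open Tournaments using (⌈n/2⌉≤1+⌊n/2⌋)

  ∣m/n-½∣<ε : ∀ m n′ (ε : ℚ) → 0ℚ ℚ.< ε → ↧ₙ ε ≤ n′ →
    suc n′ ≤ m + m → m + m ≤ 2 + suc n′ → ℚ.∣ (+ m) / suc n′ - ½ ∣ ℚ.< ε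
  ∣m/n-½∣<ε m n′ (mkℚ (+ zero) _ _) (*<* (+<+ ()))
  ∣m/n-½∣<ε m n′ (mkℚ -[1+ _ ] _ _) (*<* ())
  ∣m/n-½∣<ε m n′ (mkℚ +[1+ p ] q _) _ ↧ε≤n′ n≤m+m m+m≤2+n =
    ℚ.toℚᵘ-cancel-< (ℚᵘ.<-respˡ-≃ ∣W∣≃ (ℚᵘ.*<* cross))
    where
    n = suc n′
    -- In ℚᵘ, m/n − ½ is literally (m·2 − n)/(n·2), so only the numerator needs computing.
    W : ℚᵘ.ℚᵘ
    W = ℚᵘ.mkℚᵘ (+ m) n′ ℚᵘ.- toℚᵘ ½
    ∣W∣≃ : ℚᵘ.∣ W ∣ ℚᵘ.≃ toℚᵘ (ℚ.∣ (+ m) / n - ½ ∣)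
    ∣W∣≃ = ℚᵘ.≃-sym (ℚᵘ.≃-trans (ℚ.toℚᵘ-homo-∣-∣ ((+ m) / n - ½))
             (ℚᵘ.∣-∣-cong (ℚᵘ.≃-trans (ℚ.toℚᵘ-homo-+ ((+ m) / n) (ℚ.- ½))
               (ℚᵘ.+-cong (ℚ.toℚᵘ-fromℚᵘ (ℚᵘ.mkℚᵘ (+ m) n′)) (ℚ.toℚᵘ-homo‿- ½)))))
    m*2≡m+m : m * 2 ≡ m + m
    m*2≡m+m = trans (*-comm m 2) (cong (λ x → m + x) (+-identityʳ m))
    t : ℕ
    t = m * 2 ∸ n
    ↥W≡t : ℚᵘ.↥ W ≡ + t
    ↥W≡t = trans (cong₂ ℤ._+_ (sym (ℤ.pos-* m 2)) (ℤ.-1*i≡-i (+ n)))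
                 (ℤ.⊖-≥ (≤-trans n≤m+m (≤-reflexive (sym m*2≡m+m))))
    t≤2 : t ≤ 2
    t≤2 = m≤n+o⇒m∸n≤o (m * 2) n
            (≤-trans (≤-reflexive m*2≡m+m) (≤-trans m+m≤2+n (≤-reflexive (+-comm 2 n))))
    cross : + ℤ.∣ ℚᵘ.↥ W ∣ ℤ.* + suc q ℤ.< +[1+ p ] ℤ.* + (n * 2)
    cross rewrite ↥W≡t = subst₂ ℤ._<_ (ℤ.pos-* t (suc q)) (ℤ.pos-* (suc p) (n * 2)) (+<+ (begin-strict
      t * suc q        ≤⟨ *-mono-≤ t≤2 ↧ε≤n′ ⟩
      2 * n′           <⟨ *-monoʳ-< 2 (n<1+n n′) ⟩
      2 * n            ≡⟨ *-comm 2 n ⟩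
      n * 2            ≤⟨ m≤n*m (n * 2) (suc p) ⟩
      suc p * (n * 2)  ∎))
      where open ≤-Reasoning

  ∣1+⌈n/2⌉/1+n-½∣<ε : ∀ n (ε : ℚ) → 0ℚ ℚ.< ε → ↧ₙ ε ≤ n →
    ℚ.∣ (+ suc ⌈ n /2⌉) / suc n - ½ ∣ ℚ.< ε
  ∣1+⌈n/2⌉/1+n-½∣<ε n ε ε>0 ↧ε≤n = ∣m/n-½∣<ε (suc h) n ε ε>0 ↧ε≤n
    (s≤s (≤-trans n≤h+h (+-monoʳ-≤ h (n≤1+n h))))
    (s≤s (≤-trans (≤-reflexive (+-suc h h)) (s≤s h+h≤1+n)))
    where
    h = ⌈ n /2⌉
    n≤h+h : n ≤ h + h
    n≤h+h = ≤-trans (≤-reflexive (sym (⌊n/2⌋+⌈n/2⌉≡n n))) (+-monoˡ-≤ h (⌊n/2⌋≤⌈n/2⌉ n))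
    h+h≤1+n : h + h ≤ suc n
    h+h≤1+n = ≤-trans (+-monoˡ-≤ h (⌈n/2⌉≤1+⌊n/2⌋ n)) (s≤s (≤-reflexive (⌊n/2⌋+⌈n/2⌉≡n n)))

open import Defs
open import Data.Nat using (ℕ; _≤_; NonZero)
open import Data.Integer using (+_)
open import Data.Rational using (ℚ; 0ℚ; ½; _/_; _-_; ∣_∣; _<_)
open import Data.Product using (Σ; ∃; _×_)

open import Data.Nat using (suc; s≤s; ⌈_/2⌉)
open import Data.Nat.Properties using (≤-trans; n≤1+n)
open import Data.Product using (_,_)
open import Data.Rational using (↧ₙ_)
open Tournaments using (IsF-1+⌈n/2⌉)
open Approximation using (∣1+⌈n/2⌉/1+n-½∣<ε)

lemma4 : (k ℓ : ℕ) → 3 ≤ k → 2 ≤ ℓ →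
    (ε : ℚ) → 0ℚ < ε →
    Σ ℕ λ N → (n : ℕ) → .{{_ : NonZero n}} → N ≤ n →
      Σ ℕ λ m → IsF k ℓ n m × (∣ (+ m) / n - ½ ∣ < ε)
lemma4 (suc (suc (suc k))) ℓ (s≤s (s≤s (s≤s _))) ℓ≥2 ε ε>0 = suc (↧ₙ ε) , approximate
  where
  approximate : (n : ℕ) → .{{_ : NonZero n}} → suc (↧ₙ ε) ≤ n →
    Σ ℕ λ m → IsF (suc (suc (suc k))) ℓ n m × (∣ (+ m) / n - ½ ∣ < ε)
  approximate (suc n) (s≤s ↧ε≤n) =
    suc ⌈ n /2⌉ , IsF-1+⌈n/2⌉ k ℓ n (≤-trans (n≤1+n 1) ℓ≥2) , ∣1+⌈n/2⌉/1+n-½∣<ε n ε ε>0 ↧ε≤n
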